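{- For all positive integers $n$ and $r$, $$ \sum_{\ell=1}^n\ell H_{n-\ell}^{(r)}=\frac{n(n+r)}{r(r+1)}H_n^{(r)}-\frac{(n)^{(r)}\bigl((2 r+1)n+r^2\bigr)}{(r-1)!\,r^2(r+1)^2}\,. $$
   Context: $H_n=\sum_{j=1}^n\frac1j$; hyperharmonic numbers: $H_n^{(1)}=H_n$, $H_n^{(r)}=\sum_{\ell=1}^n H_\ell^{(r-1)}$ for $r\ge2$, and $H_0^{(r)}=0$. $(x)^{(m)}=x(x+1)\cdots(x+m-1)$ is the rising factorial. -}

module Defs where

open import Data.Nat as ℕ using (ℕ; zero; suc)
open import Data.Integer using (+_)
open import Data.Rational using (ℚ; _+_; 0ℚ; 1ℚ; _/_)

sum1 : ℕ → (ℕ → ℚ) → ℚ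
sum1 zero    f = 0ℚ
sum1 (suc n) f = sum1 n f + f (suc n)

-- 1/j as a rational (used only for j ≥ 1)
recip : ℕ → ℚ
recip zero    = 0ℚ
recip (suc k) = (+ 1) / suc k

H : ℕ → ℚ
H n = sum1 n recip

-- hyperharmonic numbers H_n^{(r)}, for r ≥ 1:
-- hyperH 1 n = H n, hyperH (suc r) n = ∑_{ℓ=1}^n hyperH r ℓ  (r ≥ 1);
-- hyperH r 0 = 0 automatically. (hyperH 0 is an unused junk value.)
hyperH : ℕ → ℕ → ℚ
hyperH zero          n = 0ℚ
hyperH (suc zero)    n = H n
hyperH (suc (suc r)) n = sum1 n (hyperH (suc r))

rising : ℕ → ℕ → ℕ
rising x zero    = 1
rising x (suc m) = rising x m ℕ.* (x ℕ.+ m)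

{-# OPTIONS --safe #-}
-- Write f = (r-1)!. Two identities between hyperharmonic numbers drive everything:
--   (n+1) H^{(r)}_{n+1} = (n+r) H^{(r)}_n + (n+1)^{(r-1)} / f,
--   r H^{(r+1)}_n       = (n+r) H^{(r)}_n - (n)^{(r)} / f.
-- The second follows from the first by induction on n, and the first for r+1 is a
-- linear combination of both for r, so both hold for all r. The left-hand side S_n of
-- the theorem satisfies S_{n+1} = S_n + H^{(r+1)}_n, and with the two identities the
-- closed form passes from n to n+1. With denominators cleared, each step is a
-- polynomial identity.
module Submission where

open import Defs
open import Data.Nat as ℕ using (ℕ; suc; _∸_)
open import Data.Nat using (_!)
open import Data.Integer using (+_)
open import Data.Rational using (ℚ; _+_; _*_; _-_; _/_)
open import Relation.Binary.PropositionalEquality using (_≡_)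

open import Data.Nat using (zero; NonZero)
import Data.Nat.Properties as ℕₚ
open import Data.Nat.Tactic.RingSolver using () renaming (solve-∀ to solve-∀-ℕ)
import Data.Integer as ℤ
import Data.Integer.Properties as ℤₚ
open import Data.Integer.Tactic.RingSolver using () renaming (solve-∀ to solve-∀-ℤ)
open import Data.Rational using (0ℚ; 1ℚ; -_; Positive; fromℚᵘ; toℚᵘ)
open import Data.Rational.Properties
  using ( toℚᵘ-injective; toℚᵘ-fromℚᵘ; toℚᵘ-homo-+; toℚᵘ-homo-*; fromℚᵘ-cong
        ; normalize-pos; *-cancelˡ-≤-pos; ≤-antisym; ≤-reflexive
        ; +-assoc; +-comm; *-comm; +-identityˡ; +-identityʳ; *-identityˡ; *-distribʳ-+
        ; +-0-commutativeMonoid )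
import Data.Rational.Unnormalised as ℚᵘ
import Data.Rational.Unnormalised.Properties as ℚᵘₚ
open import Data.Rational.Solver using (module +-*-Solver)
open +-*-Solver using (solve; _:=_; con; _:+_; _:*_; _:-_; :-_)
open import Algebra.Bundles using (CommutativeMonoid)
open import Algebra.Properties.CommutativeSemigroup
  (CommutativeMonoid.commutativeSemigroup +-0-commutativeMonoid) using (interchange)
open import Relation.Binary.PropositionalEquality using (refl; sym; trans; cong; cong₂; module ≡-Reasoning)
open ≡-Reasoning

fromℕ : ℕ → ℚ
fromℕ n = + n / 1

ℕ→ℚᵘ : ℕ → ℚᵘ.ℚᵘ
ℕ→ℚᵘ n = ℚᵘ.mkℚᵘ (+ n) 0

fromℚᵘ-homo-+ : ∀ p q → fromℚᵘ (p ℚᵘ.+ q) ≡ fromℚᵘ p + fromℚᵘ q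
fromℚᵘ-homo-+ p q = toℚᵘ-injective (ℚᵘₚ.≃-trans (toℚᵘ-fromℚᵘ (p ℚᵘ.+ q))
  (ℚᵘₚ.≃-sym (ℚᵘₚ.≃-trans (toℚᵘ-homo-+ (fromℚᵘ p) (fromℚᵘ q))
                          (ℚᵘₚ.+-cong (toℚᵘ-fromℚᵘ p) (toℚᵘ-fromℚᵘ q)))))

fromℚᵘ-homo-* : ∀ p q → fromℚᵘ (p ℚᵘ.* q) ≡ fromℚᵘ p * fromℚᵘ q
fromℚᵘ-homo-* p q = toℚᵘ-injective (ℚᵘₚ.≃-trans (toℚᵘ-fromℚᵘ (p ℚᵘ.* q))
  (ℚᵘₚ.≃-sym (ℚᵘₚ.≃-trans (toℚᵘ-homo-* (fromℚᵘ p) (fromℚᵘ q))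
                          (ℚᵘₚ.*-cong (toℚᵘ-fromℚᵘ p) (toℚᵘ-fromℚᵘ q)))))

ℕ→ℚᵘ-homo-+ : ∀ m n → ℕ→ℚᵘ (m ℕ.+ n) ℚᵘ.≃ ℕ→ℚᵘ m ℚᵘ.+ ℕ→ℚᵘ n
ℕ→ℚᵘ-homo-+ m n = ℚᵘ.*≡* (trans (cong (ℤ._* + 1) (ℤₚ.pos-+ m n)) (identity (+ m) (+ n)))
  where
  identity : ∀ x y → (x ℤ.+ y) ℤ.* + 1 ≡ (x ℤ.* + 1 ℤ.+ y ℤ.* + 1) ℤ.* + 1
  identity = solve-∀-ℤ

ℕ→ℚᵘ-homo-* : ∀ m n → ℕ→ℚᵘ (m ℕ.* n) ℚᵘ.≃ ℕ→ℚᵘ m ℚᵘ.* ℕ→ℚᵘ n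
ℕ→ℚᵘ-homo-* m n = ℚᵘ.*≡* (cong (ℤ._* + 1) (ℤₚ.pos-* m n))

fromℕ-homo-+ : ∀ m n → fromℕ (m ℕ.+ n) ≡ fromℕ m + fromℕ n
fromℕ-homo-+ m n = trans (fromℚᵘ-cong (ℕ→ℚᵘ-homo-+ m n)) (fromℚᵘ-homo-+ (ℕ→ℚᵘ m) (ℕ→ℚᵘ n))

fromℕ-homo-* : ∀ m n → fromℕ (m ℕ.* n) ≡ fromℕ m * fromℕ n
fromℕ-homo-* m n = trans (fromℚᵘ-cong (ℕ→ℚᵘ-homo-* m n)) (fromℚᵘ-homo-* (ℕ→ℚᵘ m) (ℕ→ℚᵘ n))

fromℕ-suc : ∀ n → fromℕ (suc n) ≡ fromℕ n + 1ℚ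
fromℕ-suc n = trans (cong fromℕ (ℕₚ.+-comm 1 n)) (fromℕ-homo-+ n 1)

fromℕ-suc-+ : ∀ m n → fromℕ (suc m ℕ.+ n) ≡ fromℕ m + fromℕ (suc n)
fromℕ-suc-+ m n = trans (cong fromℕ (sym (ℕₚ.+-suc m n))) (fromℕ-homo-+ m (suc n))

mkℚᵘ-*-ℕ→ℚᵘ : ∀ a d → ℚᵘ.mkℚᵘ (+ a) d ℚᵘ.* ℕ→ℚᵘ (suc d) ℚᵘ.≃ ℕ→ℚᵘ a
mkℚᵘ-*-ℕ→ℚᵘ a d = ℚᵘ.*≡* (trans (identity (+ a) (+ suc d))
  (cong (λ m → + a ℤ.* + m) (sym (ℕₚ.*-identityʳ (suc d)))))
  where
  identity : ∀ x y → (x ℤ.* y) ℤ.* + 1 ≡ x ℤ.* y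
  identity = solve-∀-ℤ

/-*-fromℕ : ∀ a d → (+ a / suc d) * fromℕ (suc d) ≡ fromℕ a
/-*-fromℕ a d = trans (sym (fromℚᵘ-homo-* (ℚᵘ.mkℚᵘ (+ a) d) (ℕ→ℚᵘ (suc d))))
                      (fromℚᵘ-cong (mkℚᵘ-*-ℕ→ℚᵘ a d))

fromℕ-suc-cancelˡ : ∀ d {p q} → fromℕ (suc d) * p ≡ fromℕ (suc d) * q → p ≡ q
fromℕ-suc-cancelˡ d eq = ≤-antisym (*-cancelˡ-≤-pos (fromℕ (suc d)) (≤-reflexive eq))
                                   (*-cancelˡ-≤-pos (fromℕ (suc d)) (≤-reflexive (sym eq)))
  where instance _ : Positive (fromℕ (suc d))
                 _ = normalize-pos (suc d) 1

-- x ≡ y follows from hypotheses aᵢ ≡ bᵢ once x = y + Σ cᵢ (aᵢ - bᵢ) is a ring identity.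
by-combination : ∀ {x y} s → x ≡ y + s → s ≡ 0ℚ → x ≡ y
by-combination {y = y} s x≡y+s s≡0 = begin
  _       ≡⟨ x≡y+s ⟩
  y + s   ≡⟨ cong (λ z → y + z) s≡0 ⟩
  y + 0ℚ  ≡⟨ +-identityʳ y ⟩
  y       ∎

vanish : ∀ c {a b s} → a ≡ b → s ≡ 0ℚ → c * (a - b) + s ≡ 0ℚ
vanish c {a} refl refl = identity c a
  where
  identity : ∀ c a → c * (a - a) + 0ℚ ≡ 0ℚ
  identity = solve 2 (λ c a → c :* (a :- a) :+ con 0ℚ := con 0ℚ) refl

sum1-cong : ∀ n {f g : ℕ → ℚ} → (∀ ℓ → f ℓ ≡ g ℓ) → sum1 n f ≡ sum1 n g
sum1-cong zero    f≗g = refl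
sum1-cong (suc n) f≗g = cong₂ _+_ (sum1-cong n f≗g) (f≗g (suc n))

sum1-+ : ∀ n (f g : ℕ → ℚ) → sum1 n (λ ℓ → f ℓ + g ℓ) ≡ sum1 n f + sum1 n g
sum1-+ zero    f g = sym (+-identityʳ 0ℚ)
sum1-+ (suc n) f g = trans (cong (_+ (f (suc n) + g (suc n))) (sum1-+ n f g))
                           (interchange (sum1 n f) (sum1 n g) (f (suc n)) (g (suc n)))

sum1-suc-first : ∀ n (f : ℕ → ℚ) → sum1 (suc n) f ≡ f 1 + sum1 n (λ ℓ → f (suc ℓ))
sum1-suc-first zero    f = +-comm 0ℚ (f 1)
sum1-suc-first (suc n) f = trans (cong (_+ f (suc (suc n))) (sum1-suc-first n f))
                                 (+-assoc (f 1) (sum1 n (λ ℓ → f (suc ℓ))) (f (suc (suc n))))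

sum1-reverse : ∀ n (f : ℕ → ℚ) → sum1 n (λ ℓ → f (n ∸ ℓ)) + f n ≡ f 0 + sum1 n f
sum1-reverse zero    f = +-comm 0ℚ (f 0)
sum1-reverse (suc n) f = begin
  sum1 (suc n) (λ ℓ → f (suc n ∸ ℓ)) + f (suc n)
    ≡⟨ cong (_+ f (suc n)) (sum1-suc-first n (λ ℓ → f (suc n ∸ ℓ))) ⟩
  (f n + sum1 n (λ ℓ → f (n ∸ ℓ))) + f (suc n)
    ≡⟨ cong (_+ f (suc n)) (trans (+-comm (f n) _) (sum1-reverse n f)) ⟩
  (f 0 + sum1 n f) + f (suc n)
    ≡⟨ +-assoc (f 0) (sum1 n f) (f (suc n)) ⟩
  f 0 + sum1 (suc n) f
    ∎

weightedSum : (ℕ → ℚ) → ℕ → ℚ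
weightedSum f n = sum1 n (λ ℓ → fromℕ ℓ * f (n ∸ ℓ))

weightedSum-suc : ∀ (f : ℕ → ℚ) → f 0 ≡ 0ℚ → ∀ n → weightedSum f (suc n) ≡ weightedSum f n + sum1 n f
weightedSum-suc f f0≡0 n = begin
  weightedSum f (suc n)
    ≡⟨ sum1-suc-first n (λ ℓ → fromℕ ℓ * f (suc n ∸ ℓ)) ⟩
  1ℚ * f n + sum1 n (λ ℓ → fromℕ (suc ℓ) * f (n ∸ ℓ))
    ≡⟨ cong₂ _+_ (*-identityˡ (f n)) (sum1-cong n split) ⟩
  f n + sum1 n (λ ℓ → fromℕ ℓ * f (n ∸ ℓ) + f (n ∸ ℓ))
    ≡⟨ cong (λ z → f n + z) (sum1-+ n (λ ℓ → fromℕ ℓ * f (n ∸ ℓ)) (λ ℓ → f (n ∸ ℓ))) ⟩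
  f n + (weightedSum f n + sum1 n (λ ℓ → f (n ∸ ℓ)))
    ≡⟨ rotate (f n) (weightedSum f n) (sum1 n (λ ℓ → f (n ∸ ℓ))) ⟩
  weightedSum f n + (sum1 n (λ ℓ → f (n ∸ ℓ)) + f n)
    ≡⟨ cong (λ z → weightedSum f n + z) (sum1-reverse n f) ⟩
  weightedSum f n + (f 0 + sum1 n f)
    ≡⟨ cong (λ z → weightedSum f n + (z + sum1 n f)) f0≡0 ⟩
  weightedSum f n + (0ℚ + sum1 n f)
    ≡⟨ cong (λ z → weightedSum f n + z) (+-identityˡ (sum1 n f)) ⟩
  weightedSum f n + sum1 n f
    ∎
  where
  split : ∀ ℓ → fromℕ (suc ℓ) * f (n ∸ ℓ) ≡ fromℕ ℓ * f (n ∸ ℓ) + f (n ∸ ℓ)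
  split ℓ = trans (cong (_* f (n ∸ ℓ)) (fromℕ-suc ℓ)) (trans (*-distribʳ-+ (f (n ∸ ℓ)) (fromℕ ℓ) 1ℚ)
                  (cong (λ z → fromℕ ℓ * f (n ∸ ℓ) + z) (*-identityˡ (f (n ∸ ℓ)))))
  rotate : ∀ a b c → a + (b + c) ≡ b + (c + a)
  rotate = solve 3 (λ a b c → a :+ (b :+ c) := b :+ (c :+ a)) refl

rising-suc-first : ∀ x m → rising x (suc m) ≡ x ℕ.* rising (suc x) m
rising-suc-first x zero    = identity x
  where
  identity : ∀ x → 1 ℕ.* (x ℕ.+ 0) ≡ x ℕ.* 1
  identity = solve-∀-ℕ
rising-suc-first x (suc m) = begin
  rising x (suc m) ℕ.* (x ℕ.+ suc m)          ≡⟨ cong (ℕ._* (x ℕ.+ suc m)) (rising-suc-first x m) ⟩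
  x ℕ.* rising (suc x) m ℕ.* (x ℕ.+ suc m)    ≡⟨ identity x (rising (suc x) m) m ⟩
  x ℕ.* (rising (suc x) m ℕ.* (suc x ℕ.+ m))  ∎
  where
  identity : ∀ x R m → x ℕ.* R ℕ.* (x ℕ.+ suc m) ≡ x ℕ.* (R ℕ.* (suc x ℕ.+ m))
  identity = solve-∀-ℕ

hyperH-zero : ∀ k → hyperH (suc k) 0 ≡ 0ℚ
hyperH-zero zero    = refl
hyperH-zero (suc k) = refl

harmonic-step : ∀ N H x → (N + 1ℚ) * x ≡ 1ℚ → (N + 1ℚ) * (H + x) * 1ℚ ≡ (N + 1ℚ) * H * 1ℚ + 1ℚ
harmonic-step N H x eq = by-combination _ (identity N H x) (vanish 1ℚ eq refl)
  where
  identity : ∀ N H x →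
    (N + 1ℚ) * (H + x) * 1ℚ ≡ (N + 1ℚ) * H * 1ℚ + 1ℚ + (1ℚ * ((N + 1ℚ) * x - 1ℚ) + 0ℚ)
  identity = solve 3 (λ N H x →
    (N :+ con 1ℚ) :* (H :+ x) :* con 1ℚ
      := (N :+ con 1ℚ) :* H :* con 1ℚ :+ con 1ℚ :+ (con 1ℚ :* ((N :+ con 1ℚ) :* x :- con 1ℚ) :+ con 0ℚ)) refl

raise-order-base : ∀ r f h₀ c₀ → h₀ ≡ 0ℚ → r * r * f * 0ℚ ≡ r * f * (0ℚ + r) * h₀ - 0ℚ * c₀
raise-order-base r f _ c₀ refl = identity r f c₀
  where
  identity : ∀ r f c₀ → r * r * f * 0ℚ ≡ r * f * (0ℚ + r) * 0ℚ - 0ℚ * c₀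
  identity = solve 3 (λ r f c₀ → r :* r :* f :* con 0ℚ := r :* f :* (con 0ℚ :+ r) :* con 0ℚ :- con 0ℚ :* c₀) refl

raise-order-step : ∀ r f N h₀ h₁ g₀ c₀ c₁ {N₁} → N₁ ≡ N + 1ℚ →
  r * r * f * g₀ ≡ r * f * (N + r) * h₀ - N * c₀ →
  (N + 1ℚ) * h₁ * f ≡ (N + r) * h₀ * f + c₀ →
  c₀ * (N + r) ≡ (N + 1ℚ) * c₁ →
  r * r * f * (g₀ + h₁) ≡ r * f * (N₁ + r) * h₁ - N₁ * c₁
raise-order-step r f N h₀ h₁ g₀ c₀ c₁ refl raise recur c-step =
  by-combination _ (identity r f N h₀ h₁ g₀ c₀ c₁)
    (vanish 1ℚ raise (vanish (- r) recur (vanish (- 1ℚ) c-step refl)))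
  where
  identity : ∀ r f N h₀ h₁ g₀ c₀ c₁ →
    r * r * f * (g₀ + h₁) ≡ r * f * ((N + 1ℚ) + r) * h₁ - (N + 1ℚ) * c₁
      + (1ℚ * (r * r * f * g₀ - (r * f * (N + r) * h₀ - N * c₀))
      + ((- r) * ((N + 1ℚ) * h₁ * f - ((N + r) * h₀ * f + c₀))
      + ((- 1ℚ) * (c₀ * (N + r) - (N + 1ℚ) * c₁) + 0ℚ)))
  identity = solve 8 (λ r f N h₀ h₁ g₀ c₀ c₁ →
    r :* r :* f :* (g₀ :+ h₁)
      := r :* f :* ((N :+ con 1ℚ) :+ r) :* h₁ :- (N :+ con 1ℚ) :* c₁
      :+ (con 1ℚ :* (r :* r :* f :* g₀ :- (r :* f :* (N :+ r) :* h₀ :- N :* c₀))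
      :+ ((:- r) :* ((N :+ con 1ℚ) :* h₁ :* f :- ((N :+ r) :* h₀ :* f :+ c₀))
      :+ ((:- con 1ℚ) :* (c₀ :* (N :+ r) :- (N :+ con 1ℚ) :* c₁) :+ con 0ℚ)))) refl

-- The recurrence for order r + 1 is a combination of the hypotheses only after
-- multiplying by r, which is cancelled afterwards.
recurrence-step : ∀ r f N h₀ h₁ g₀ c₀ c₁ {N₁ f′ r′ c′} →
  N₁ ≡ N + 1ℚ → f′ ≡ r * f → r′ ≡ r + 1ℚ → c′ ≡ c₀ * (N + r) →
  r * r * f * g₀ ≡ r * f * (N + r) * h₀ - N * c₀ →
  r * r * f * (g₀ + h₁) ≡ r * f * (N₁ + r) * h₁ - N₁ * c₁ →
  (N + 1ℚ) * h₁ * f ≡ (N + r) * h₀ * f + c₀ →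
  c₀ * (N + r) ≡ (N + 1ℚ) * c₁ →
  r * ((N + 1ℚ) * (g₀ + h₁) * f′) ≡ r * ((N + r′) * g₀ * f′ + c′)
recurrence-step r f N h₀ h₁ g₀ c₀ c₁ refl refl refl refl raise₀ raise₁ recur c-step =
  by-combination _ (identity r f N h₀ h₁ g₀ c₀ c₁)
    (vanish (N + 1ℚ) raise₁ (vanish (- (N + r + 1ℚ)) raise₀
      (vanish (r * (N + 1ℚ + r)) recur (vanish (N + 1ℚ) c-step refl))))
  where
  identity : ∀ r f N h₀ h₁ g₀ c₀ c₁ →
    r * ((N + 1ℚ) * (g₀ + h₁) * (r * f)) ≡ r * ((N + (r + 1ℚ)) * g₀ * (r * f) + c₀ * (N + r))
      + ((N + 1ℚ) * (r * r * f * (g₀ + h₁) - (r * f * ((N + 1ℚ) + r) * h₁ - (N + 1ℚ) * c₁))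
      + ((- (N + r + 1ℚ)) * (r * r * f * g₀ - (r * f * (N + r) * h₀ - N * c₀))
      + (r * (N + 1ℚ + r) * ((N + 1ℚ) * h₁ * f - ((N + r) * h₀ * f + c₀))
      + ((N + 1ℚ) * (c₀ * (N + r) - (N + 1ℚ) * c₁) + 0ℚ))))
  identity = solve 8 (λ r f N h₀ h₁ g₀ c₀ c₁ →
    r :* ((N :+ con 1ℚ) :* (g₀ :+ h₁) :* (r :* f))
      := r :* ((N :+ (r :+ con 1ℚ)) :* g₀ :* (r :* f) :+ c₀ :* (N :+ r))
      :+ ((N :+ con 1ℚ) :* (r :* r :* f :* (g₀ :+ h₁) :- (r :* f :* ((N :+ con 1ℚ) :+ r) :* h₁ :- (N :+ con 1ℚ) :* c₁))
      :+ ((:- (N :+ r :+ con 1ℚ)) :* (r :* r :* f :* g₀ :- (r :* f :* (N :+ r) :* h₀ :- N :* c₀))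
      :+ (r :* (N :+ con 1ℚ :+ r) :* ((N :+ con 1ℚ) :* h₁ :* f :- ((N :+ r) :* h₀ :* f :+ c₀))
      :+ ((N :+ con 1ℚ) :* (c₀ :* (N :+ r) :- (N :+ con 1ℚ) :* c₁) :+ con 0ℚ))))) refl

weightedSum-base : ∀ r f h₀ c₀ {W₀} → h₀ ≡ 0ℚ → W₀ ≡ 0ℚ * c₀ →
  f * (r * r) * ((r + 1ℚ) * (r + 1ℚ)) * 0ℚ
    ≡ f * r * (r + 1ℚ) * (0ℚ * (0ℚ + r)) * h₀ - W₀ * ((r + r + 1ℚ) * 0ℚ + r * r)
weightedSum-base r f _ c₀ refl refl = identity r f c₀
  where
  identity : ∀ r f c₀ → f * (r * r) * ((r + 1ℚ) * (r + 1ℚ)) * 0ℚ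
    ≡ f * r * (r + 1ℚ) * (0ℚ * (0ℚ + r)) * 0ℚ - 0ℚ * c₀ * ((r + r + 1ℚ) * 0ℚ + r * r)
  identity = solve 3 (λ r f c₀ →
    f :* (r :* r) :* ((r :+ con 1ℚ) :* (r :+ con 1ℚ)) :* con 0ℚ
      := f :* r :* (r :+ con 1ℚ) :* (con 0ℚ :* (con 0ℚ :+ r)) :* con 0ℚ
         :- con 0ℚ :* c₀ :* ((r :+ r :+ con 1ℚ) :* con 0ℚ :+ r :* r)) refl

weightedSum-step : ∀ r f N S h₀ h₁ g₀ c₀ {N₁ S₁ W₀ W₁} →
  S₁ ≡ S + g₀ → N₁ ≡ N + 1ℚ → W₀ ≡ N * c₀ → W₁ ≡ c₀ * (N + r) →
  f * (r * r) * ((r + 1ℚ) * (r + 1ℚ)) * S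
    ≡ f * r * (r + 1ℚ) * (N * (N + r)) * h₀ - W₀ * ((r + r + 1ℚ) * N + r * r) →
  r * r * f * g₀ ≡ r * f * (N + r) * h₀ - N * c₀ →
  (N + 1ℚ) * h₁ * f ≡ (N + r) * h₀ * f + c₀ →
  f * (r * r) * ((r + 1ℚ) * (r + 1ℚ)) * S₁
    ≡ f * r * (r + 1ℚ) * (N₁ * (N₁ + r)) * h₁ - W₁ * ((r + r + 1ℚ) * N₁ + r * r)
weightedSum-step r f N S h₀ h₁ g₀ c₀ refl refl refl refl sum raise recur =
  by-combination _ (identity r f N S g₀ h₀ h₁ c₀)
    (vanish 1ℚ sum (vanish ((r + 1ℚ) * (r + 1ℚ)) raise
      (vanish (- (r * (r + 1ℚ) * ((N + 1ℚ) + r))) recur refl)))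
  where
  identity : ∀ r f N S g₀ h₀ h₁ c₀ →
    f * (r * r) * ((r + 1ℚ) * (r + 1ℚ)) * (S + g₀)
      ≡ f * r * (r + 1ℚ) * ((N + 1ℚ) * ((N + 1ℚ) + r)) * h₁ - (c₀ * (N + r)) * ((r + r + 1ℚ) * (N + 1ℚ) + r * r)
      + (1ℚ * (f * (r * r) * ((r + 1ℚ) * (r + 1ℚ)) * S
                - (f * r * (r + 1ℚ) * (N * (N + r)) * h₀ - (N * c₀) * ((r + r + 1ℚ) * N + r * r)))
      + ((r + 1ℚ) * (r + 1ℚ) * (r * r * f * g₀ - (r * f * (N + r) * h₀ - N * c₀))
      + ((- (r * (r + 1ℚ) * ((N + 1ℚ) + r))) * ((N + 1ℚ) * h₁ * f - ((N + r) * h₀ * f + c₀))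
      + 0ℚ)))
  identity = solve 8 (λ r f N S g₀ h₀ h₁ c₀ →
    f :* (r :* r) :* ((r :+ con 1ℚ) :* (r :+ con 1ℚ)) :* (S :+ g₀)
      := f :* r :* (r :+ con 1ℚ) :* ((N :+ con 1ℚ) :* ((N :+ con 1ℚ) :+ r)) :* h₁
         :- (c₀ :* (N :+ r)) :* ((r :+ r :+ con 1ℚ) :* (N :+ con 1ℚ) :+ r :* r)
      :+ (con 1ℚ :* (f :* (r :* r) :* ((r :+ con 1ℚ) :* (r :+ con 1ℚ)) :* S
                :- (f :* r :* (r :+ con 1ℚ) :* (N :* (N :+ r)) :* h₀ :- (N :* c₀) :* ((r :+ r :+ con 1ℚ) :* N :+ r :* r)))
      :+ ((r :+ con 1ℚ) :* (r :+ con 1ℚ) :* (r :* r :* f :* g₀ :- (r :* f :* (N :+ r) :* h₀ :- N :* c₀))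
      :+ ((:- (r :* (r :+ con 1ℚ) :* ((N :+ con 1ℚ) :+ r))) :* ((N :+ con 1ℚ) :* h₁ :* f :- ((N :+ r) :* h₀ :* f :+ c₀))
      :+ con 0ℚ)))) refl

clear-denominators : ∀ r f h T X₁ X₂ E₁ E₂ →
  f * (r * r) * ((r + 1ℚ) * (r + 1ℚ)) * T ≡ f * r * (r + 1ℚ) * E₁ * h - E₂ →
  X₁ * (r * (r + 1ℚ)) ≡ E₁ → X₂ * (f * (r * r) * ((r + 1ℚ) * (r + 1ℚ))) ≡ E₂ →
  f * (r * r) * ((r + 1ℚ) * (r + 1ℚ)) * T ≡ f * (r * r) * ((r + 1ℚ) * (r + 1ℚ)) * (X₁ * h - X₂)
clear-denominators r f h T X₁ X₂ _ _ eq refl refl = trans eq (identity r f h X₁ X₂)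
  where
  identity : ∀ r f h X₁ X₂ →
    f * r * (r + 1ℚ) * (X₁ * (r * (r + 1ℚ))) * h - X₂ * (f * (r * r) * ((r + 1ℚ) * (r + 1ℚ)))
      ≡ f * (r * r) * ((r + 1ℚ) * (r + 1ℚ)) * (X₁ * h - X₂)
  identity = solve 5 (λ r f h X₁ X₂ →
    f :* r :* (r :+ con 1ℚ) :* (X₁ :* (r :* (r :+ con 1ℚ))) :* h :- X₂ :* (f :* (r :* r) :* ((r :+ con 1ℚ) :* (r :+ con 1ℚ)))
      := f :* (r :* r) :* ((r :+ con 1ℚ) :* (r :+ con 1ℚ)) :* (X₁ :* h :- X₂)) refl

module Level (k : ℕ) where

  r f : ℚ
  r = fromℕ (suc k)
  f = fromℕ (k !)

  h : ℕ → ℚ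
  h = hyperH (suc k)

  c : ℕ → ℚ
  c n = fromℕ (rising (suc n) k)

  Recurrence : ℕ → Set
  Recurrence n = (fromℕ n + 1ℚ) * h (suc n) * f ≡ (fromℕ n + r) * h n * f + c n

  rising-split : ∀ n → fromℕ (rising n (suc k)) ≡ fromℕ n * c n
  rising-split n = trans (cong fromℕ (rising-suc-first n k)) (fromℕ-homo-* n (rising (suc n) k))

  rising-suc-split : ∀ n → fromℕ (rising (suc n) (suc k)) ≡ c n * (fromℕ n + r)
  rising-suc-split n = trans (fromℕ-homo-* (rising (suc n) k) (suc n ℕ.+ k))
                             (cong (c n *_) (fromℕ-suc-+ n k))

  c-suc : ∀ n → c n * (fromℕ n + r) ≡ (fromℕ n + 1ℚ) * c (suc n)
  c-suc n = begin
    c n * (fromℕ n + r)             ≡⟨ sym (rising-suc-split n) ⟩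
    fromℕ (rising (suc n) (suc k))  ≡⟨ rising-split (suc n) ⟩
    fromℕ (suc n) * c (suc n)       ≡⟨ cong (_* c (suc n)) (fromℕ-suc n) ⟩
    (fromℕ n + 1ℚ) * c (suc n)      ∎

  fromℕ-r*[r+1] : fromℕ (suc k ℕ.* suc (suc k)) ≡ r * (r + 1ℚ)
  fromℕ-r*[r+1] = trans (fromℕ-homo-* (suc k) (suc (suc k))) (cong (r *_) (fromℕ-suc (suc k)))

  fromℕ-n*[n+r] : ∀ n → fromℕ (n ℕ.* (n ℕ.+ suc k)) ≡ fromℕ n * (fromℕ n + r)
  fromℕ-n*[n+r] n = trans (fromℕ-homo-* n (n ℕ.+ suc k)) (cong (fromℕ n *_) (fromℕ-homo-+ n (suc k)))

  fromℕ-2r+1 : fromℕ (2 ℕ.* suc k ℕ.+ 1) ≡ r + r + 1ℚ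
  fromℕ-2r+1 = trans (cong fromℕ (identity (suc k)))
                     (trans (fromℕ-homo-+ (suc k ℕ.+ suc k) 1) (cong (_+ 1ℚ) (fromℕ-homo-+ (suc k) (suc k))))
    where
    identity : ∀ m → 2 ℕ.* m ℕ.+ 1 ≡ m ℕ.+ m ℕ.+ 1
    identity = solve-∀-ℕ

  fromℕ-numerator : ∀ n → fromℕ (rising n (suc k) ℕ.* ((2 ℕ.* suc k ℕ.+ 1) ℕ.* n ℕ.+ suc k ℕ.* suc k))
    ≡ fromℕ (rising n (suc k)) * ((r + r + 1ℚ) * fromℕ n + r * r)
  fromℕ-numerator n = trans (fromℕ-homo-* (rising n (suc k)) _) (cong (fromℕ (rising n (suc k)) *_)
    (trans (fromℕ-homo-+ ((2 ℕ.* suc k ℕ.+ 1) ℕ.* n) (suc k ℕ.* suc k))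
      (cong₂ _+_ (trans (fromℕ-homo-* (2 ℕ.* suc k ℕ.+ 1) n) (cong (_* fromℕ n) fromℕ-2r+1))
                 (fromℕ-homo-* (suc k) (suc k)))))

  denominator : ℕ
  denominator = k ! ℕ.* (suc k ℕ.* suc k) ℕ.* (suc (suc k) ℕ.* suc (suc k))

  fromℕ-denominator : fromℕ (suc (denominator ∸ 1)) ≡ f * (r * r) * ((r + 1ℚ) * (r + 1ℚ))
  fromℕ-denominator = begin
    fromℕ (suc (denominator ∸ 1))
      ≡⟨ cong fromℕ (ℕₚ.suc-pred denominator {{denominator≢0}}) ⟩
    fromℕ (k ! ℕ.* (suc k ℕ.* suc k) ℕ.* (suc (suc k) ℕ.* suc (suc k)))
      ≡⟨ fromℕ-homo-* (k ! ℕ.* (suc k ℕ.* suc k)) (suc (suc k) ℕ.* suc (suc k)) ⟩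
    fromℕ (k ! ℕ.* (suc k ℕ.* suc k)) * fromℕ (suc (suc k) ℕ.* suc (suc k))
      ≡⟨ cong₂ _*_ (trans (fromℕ-homo-* (k !) (suc k ℕ.* suc k)) (cong (f *_) (fromℕ-homo-* (suc k) (suc k))))
                   (trans (fromℕ-homo-* (suc (suc k)) (suc (suc k))) (cong₂ _*_ (fromℕ-suc (suc k)) (fromℕ-suc (suc k)))) ⟩
    f * (r * r) * ((r + 1ℚ) * (r + 1ℚ))
      ∎
    where
    denominator≢0 : NonZero denominator
    denominator≢0 = ℕₚ.m*n≢0 (k ! ℕ.* (suc k ℕ.* suc k)) _ {{ℕₚ.m*n≢0 (k !) _ {{k ℕₚ.!≢0}}}}

  module _ (recurrence : ∀ n → Recurrence n) where

    hyperH-raise-order : ∀ n →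
      r * r * f * hyperH (suc (suc k)) n ≡ r * f * (fromℕ n + r) * h n - fromℕ n * c n
    hyperH-raise-order zero    = raise-order-base r f (h 0) (c 0) (hyperH-zero k)
    hyperH-raise-order (suc n) =
      raise-order-step r f (fromℕ n) (h n) (h (suc n)) (hyperH (suc (suc k)) n) (c n) (c (suc n))
        (fromℕ-suc n) (hyperH-raise-order n) (recurrence n) (c-suc n)

    weightedSum-hyperH : ∀ n →
      f * (r * r) * ((r + 1ℚ) * (r + 1ℚ)) * weightedSum h n
        ≡ f * r * (r + 1ℚ) * (fromℕ n * (fromℕ n + r)) * h n
          - fromℕ (rising n (suc k)) * ((r + r + 1ℚ) * fromℕ n + r * r)
    weightedSum-hyperH zero    = weightedSum-base r f (h 0) (c 0) (hyperH-zero k) (rising-split 0)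
    weightedSum-hyperH (suc n) =
      weightedSum-step r f (fromℕ n) (weightedSum h n) (h n) (h (suc n)) (hyperH (suc (suc k)) n) (c n)
        (weightedSum-suc h (hyperH-zero k) n) (fromℕ-suc n) (rising-split n)
        (rising-suc-split n) (weightedSum-hyperH n) (hyperH-raise-order n) (recurrence n)

harmonic-recurrence : ∀ n → Level.Recurrence 0 n
harmonic-recurrence n = harmonic-step (fromℕ n) (H n) (+ 1 / suc n) (begin
  (fromℕ n + 1ℚ) * (+ 1 / suc n)  ≡⟨ cong (_* (+ 1 / suc n)) (sym (fromℕ-suc n)) ⟩
  fromℕ (suc n) * (+ 1 / suc n)   ≡⟨ *-comm (fromℕ (suc n)) (+ 1 / suc n) ⟩
  (+ 1 / suc n) * fromℕ (suc n)   ≡⟨ /-*-fromℕ 1 n ⟩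
  1ℚ                              ∎)

recurrence-suc : ∀ k → (∀ n → Level.Recurrence k n) → ∀ n → Level.Recurrence (suc k) n
recurrence-suc k recurrence n = fromℕ-suc-cancelˡ k
  (recurrence-step r f (fromℕ n) (h n) (h (suc n)) (hyperH (suc (suc k)) n) (c n) (c (suc n))
    (fromℕ-suc n) (fromℕ-homo-* (suc k) (k !)) (fromℕ-suc (suc k)) (rising-suc-split n)
    (hyperH-raise-order recurrence n) (hyperH-raise-order recurrence (suc n)) (recurrence n) (c-suc n))
  where open Level k

recurrence : ∀ k n → Level.Recurrence k n
recurrence zero    = harmonic-recurrence
recurrence (suc k) = recurrence-suc k (recurrence k)

corollary4 : (n r : ℕ) → 1 ℕ.≤ n → 1 ℕ.≤ r →
    sum1 n (λ ℓ → ((+ ℓ) / 1) * hyperH r (n ∸ ℓ))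
      ≡ ((+ (n ℕ.* (n ℕ.+ r))) / suc (r ℕ.* suc r ℕ.∸ 1)) * hyperH r n
        - (+ (rising n r ℕ.* ((2 ℕ.* r ℕ.+ 1) ℕ.* n ℕ.+ r ℕ.* r)))
          / suc ((r ∸ 1) ! ℕ.* (r ℕ.* r) ℕ.* (suc r ℕ.* suc r) ℕ.∸ 1)
corollary4 n (suc k) _ _ = fromℕ-suc-cancelˡ (denominator ∸ 1) (begin
  fromℕ (suc (denominator ∸ 1)) * weightedSum h n         ≡⟨ cong (_* weightedSum h n) fromℕ-denominator ⟩
  f * (r * r) * ((r + 1ℚ) * (r + 1ℚ)) * weightedSum h n   ≡⟨ clear-denominators r f (h n) (weightedSum h n) X₁ X₂ _ _
                                                                (weightedSum-hyperH (recurrence k) n) X₁-eq X₂-eq ⟩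
  f * (r * r) * ((r + 1ℚ) * (r + 1ℚ)) * (X₁ * h n - X₂)   ≡⟨ cong (_* (X₁ * h n - X₂)) (sym fromℕ-denominator) ⟩
  fromℕ (suc (denominator ∸ 1)) * (X₁ * h n - X₂)         ∎)
  where
  open Level k
  numerator : ℕ
  numerator = rising n (suc k) ℕ.* ((2 ℕ.* suc k ℕ.+ 1) ℕ.* n ℕ.+ suc k ℕ.* suc k)
  X₁ X₂ : ℚ
  X₁ = + (n ℕ.* (n ℕ.+ suc k)) / suc (suc k ℕ.* suc (suc k) ∸ 1)
  X₂ = + numerator / suc (denominator ∸ 1)
  X₁-eq : X₁ * (r * (r + 1ℚ)) ≡ fromℕ n * (fromℕ n + r)
  X₁-eq = trans (cong (X₁ *_) (sym fromℕ-r*[r+1])) (trans (/-*-fromℕ (n ℕ.* (n ℕ.+ suc k)) (suc k ℕ.* suc (suc k) ∸ 1)) (fromℕ-n*[n+r] n))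
  X₂-eq : X₂ * (f * (r * r) * ((r + 1ℚ) * (r + 1ℚ))) ≡ fromℕ (rising n (suc k)) * ((r + r + 1ℚ) * fromℕ n + r * r)
  X₂-eq = trans (cong (X₂ *_) (sym fromℕ-denominator)) (trans (/-*-fromℕ numerator (denominator ∸ 1)) (fromℕ-numerator n))
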